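{- For every hypertree $\mathcal{T}$, $\gamma_{P_I}(\mathcal{T})\le\mathrm{spi}(\mathcal{T})$.
   Context: A hypergraph $\mathcal{H}=(V,E)$ has finite vertex set $V$ and edges nonempty subsets of $V$; hypergraphs are reduced (no edge is contained in another distinct edge). A path is a sequence $v_1,e_1,v_2,\dots,e_\ell,v_{\ell+1}$ of distinct vertices and distinct edges with $v_i,v_{i+1}\in e_i$; $\mathcal{H}$ is connected if any two vertices are joined by a path. A Berge cycle is a sequence $(v_1,e_1,v_2,e_2,\dots,v_m,e_m,v_1)$ with distinct vertices $v_i$ and distinct edges $e_i$, $v_i,v_{i+1}\in e_i$ (indices mod $m$). A hypertree is a connected hypergraph with no Berge cycle. For $V'\subseteq V$, the subhypergraph induced by $V'$ has vertex set $V'$ and edge set $\{e\cap V': e\in E,\ e\cap V'\neq\varnothing,\ \text{and either } e \text{ is a loop (a one-vertex edge) or } |e\cap V'|\ge 2\}$. $\deg(v)$ is the number of edges containing $v$; a major vertex has degree at least $3$. A spider is a nonempty hypertree with at most one major vertex. A spider cover of a hypertree $\mathcal{T}$ is a partition of $V(\mathcal{T})$ into sets each inducing a spider; $\mathrm{spi}(\mathcal{T})$ is the minimum size of a spider cover. $N[a]=\bigcup_{a\in e\in E}e$. Infectious power domination: given $S_0\subseteq V$, set $S=\bigcup_{v\in S_0}N[v]$; then while some nonempty $A\subseteq S$ and edge $e$ satisfy $A\subseteq e$ and [every vertex $v\notin S$ such that $A\cup\{v\}$ is contained in some edge lies in $e$], add the vertices of $e$ to $S$. $\gamma_{P_I}(\mathcal{H})$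 is the minimum size of an $S_0$ with $S=V$ at termination. -}

module Defs where

open import Data.Nat using (ℕ; zero; suc; _≤_; _≤ᵇ_; _≡ᵇ_; _<?_)
open import Data.Bool using (Bool; _∧_; _∨_; if_then_else_)
open import Data.Bool.Properties using () renaming (_≟_ to _≟ᴮ_)
open import Data.Fin using (Fin; zero; suc; toℕ; fromℕ; fromℕ<; inject₁) renaming (_≟_ to _≟ᶠ_)
open import Data.Fin.Subset using (Subset; _∈_; _∉_; _⊆_; _∪_; _∩_; ⁅_⁆; ⋃; ∣_∣; Nonempty; ⊤)
open import Data.Fin.Subset.Properties using (_∈?_)
open import Data.List using (List; []; _∷_; map; filter; length; deduplicate; allFin)
open import Data.List.Membership.Propositional using () renaming (_∈_ to _∈ₗ_)
open import Data.Vec using (tabulate)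
open import Data.Vec.Properties using (≡-dec)
open import Data.Product using (Σ; ∃; _×_; _,_)
open import Relation.Nullary using (¬_; does; yes; no)
open import Relation.Binary.PropositionalEquality using (_≡_)
open import Relation.Binary.Construct.Closure.ReflexiveTransitive using (Star)
open import Function.Definitions using (Injective)

-- Edges are subsets of Fin n (Bool vectors, so value equality = set equality);
-- the edge SET is the set of subsets occurring in the list E.
record Hypergraph (n : ℕ) : Set where
  constructor hg
  field
    V : Subset n
    E : List (Subset n)
open Hypergraph public

Reduced : ∀ {n} → List (Subset n) → Set
Reduced E = ∀ e f → e ∈ₗ E → f ∈ₗ E → e ⊆ f → e ≡ f

record Path {n} (H : Hypergraph n) (ℓ : ℕ) : Set where
  field
    vtx     : Fin (suc ℓ) → Fin n
    edg     : Fin ℓ → Subset n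
    vtx-inj : Injective _≡_ _≡_ vtx
    edg-inj : Injective _≡_ _≡_ edg
    vtx∈V   : ∀ i → vtx i ∈ V H
    edg∈E   : ∀ i → edg i ∈ₗ E H
    left    : ∀ i → vtx (inject₁ i) ∈ edg i
    right   : ∀ i → vtx (suc i) ∈ edg i
open Path public

Connected : ∀ {n} → Hypergraph n → Set
Connected H = ∀ a b → a ∈ V H → b ∈ V H →
  ∃ λ ℓ → Σ (Path H ℓ) λ p → (vtx p zero ≡ a) × (vtx p (fromℕ ℓ) ≡ b)

next : ∀ {m} → Fin (suc m) → Fin (suc m)
next {m} i with toℕ i <? m
... | yes p = suc (fromℕ< p)
... | no _  = zero

-- Berge cycle (v_1,e_1,...,v_m,e_m,v_1) of length m = suc (suc k) ≥ 2.
record BergeCycle {n} (H : Hypergraph n) (k : ℕ) : Set where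
  field
    vtx     : Fin (suc (suc k)) → Fin n
    edg     : Fin (suc (suc k)) → Subset n
    vtx-inj : Injective _≡_ _≡_ vtx
    edg-inj : Injective _≡_ _≡_ edg
    vtx∈V   : ∀ i → vtx i ∈ V H
    edg∈E   : ∀ i → edg i ∈ₗ E H
    here    : ∀ i → vtx i ∈ edg i
    there   : ∀ i → vtx (next i) ∈ edg i

Hypertree : ∀ {n} → Hypergraph n → Set
Hypertree H = Connected H × ¬ (∃ λ k → BergeCycle H k)

-- Induced subhypergraph on V': edges e ∩ V' that are nonempty and
-- either e is a loop (|e| = 1) or |e ∩ V'| ≥ 2.
keep : ∀ {n} → Subset n → Subset n → Bool
keep e X = (1 ≤ᵇ ∣ X ∣) ∧ ((∣ e ∣ ≡ᵇ 1) ∨ (2 ≤ᵇ ∣ X ∣))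

inducedEdges : ∀ {n} → Subset n → List (Subset n) → List (Subset n)
inducedEdges V' [] = []
inducedEdges V' (e ∷ es) =
  if keep e (e ∩ V') then (e ∩ V') ∷ inducedEdges V' es else inducedEdges V' es

induced : ∀ {n} → Hypergraph n → Subset n → Hypergraph n
induced H V' = hg V' (inducedEdges V' (E H))

deg : ∀ {n} → Hypergraph n → Fin n → ℕ
deg H v = length (deduplicate (≡-dec _≟ᴮ_) (filter (v ∈?_) (E H)))

Major : ∀ {n} → Hypergraph n → Fin n → Set
Major H v = 3 ≤ deg H v

Spider : ∀ {n} → Hypergraph n → Set
Spider H = Nonempty (V H) × Hypertree H ×
  (∀ u w → u ∈ V H → w ∈ V H → Major H u → Major H w → u ≡ w)

block : ∀ {n k} → (Fin n → Fin k) → Fin k → Subset n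
block c j = tabulate (λ x → does (c x ≟ᶠ j))

-- A spider cover of size k: partition of V(T) into k classes (given by a
-- labelling), each class inducing a spider (hence nonempty).
SpiderCover : ∀ {n k} → Hypergraph n → (Fin n → Fin k) → Set
SpiderCover T c = ∀ j → Spider (induced T (block c j))

N[_] : ∀ {n} → Fin n → Hypergraph n → Subset n
N[ a ] H = ⁅ a ⁆ ∪ ⋃ (filter (a ∈?_) (E H))

initial : ∀ {n} → Hypergraph n → Subset n → Subset n
initial {n} H S₀ = ⋃ (map (λ v → N[ v ] H) (filter (_∈? S₀) (allFin n)))

Step : ∀ {n} → Hypergraph n → Subset n → Subset n → Set
Step H S S' = ∃ λ A → ∃ λ e →
  Nonempty A × A ⊆ S × e ∈ₗ E H × A ⊆ e ×
  (∀ v → v ∉ S → (∃ λ f → f ∈ₗ E H × (A ∪ ⁅ v ⁆) ⊆ f) → v ∈ e) ×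
  S' ≡ S ∪ e

IPDSet : ∀ {n} → Hypergraph n → Subset n → Set
IPDSet H S₀ = Star (Step H) (initial H S₀) ⊤

γPI≤ : ∀ {n} → Hypergraph n → ℕ → Set
γPI≤ H k = ∃ λ S₀ → ∣ S₀ ∣ ≤ k × IPDSet H S₀

-- Given a spider cover with k spiders, pick in each spider its centre (its
-- unique major vertex, or any vertex).  These ≤ k centres infect T:
-- starting from their closed neighbourhoods, run the infection rule until
-- it stalls (runToStall).  In a linear hypergraph a stalled set S is
-- absorbing (an edge with two infected vertices is infected) and escaping
-- (an infected vertex a of a partially infected edge e shares another edge
-- with an uninfected vertex outside e).  If some vertex u were uninfected,
-- walk from u along its spider leg towards the centre; at the last
-- uninfected point the escape rule forces a jump to another spider (a
-- jump inside the spider would make the jumping vertex major, hence the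
-- centre), where the walk continues along a leg again.  This walk never
-- backtracks, which is impossible in a Berge-acyclic hypergraph: its first
-- repetition closes a Berge cycle.
module Submission where

open import Defs
open import Data.Nat using (ℕ; zero; suc; _+_; _≤_; _<_; z≤n; s≤s; _<?_; _≤?_; _≤ᵇ_; _≡ᵇ_)
open import Data.Nat.Properties
open import Data.Nat.Induction using (<-rec)
open import Data.Bool using (true; false; _∧_; _∨_)
open import Data.Bool.Properties using () renaming (_≟_ to _≟ᴮ_)
open import Data.Fin using (Fin; zero; suc; toℕ; fromℕ; fromℕ<; inject₁)
open import Data.Fin.Properties using (any?; toℕ-fromℕ<; toℕ-injective; toℕ<n; toℕ-inject₁; toℕ-fromℕ; pigeonhole) renaming (_≟_ to _≟ᶠ_)
open import Data.Fin.Subset using (Subset; _∈_; _∉_; _⊆_; _∪_; _∩_; ⁅_⁆; ∣_∣; ⋃; Nonempty; ⊤) renaming (⊥ to ∅)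
open import Data.Fin.Subset.Properties using (∈⊤; ⊆⊤; ∉⊥; _∈?_; _⊆?_; ⊆-antisym; x∈p∪q⁺; x∈p∪q⁻; x∈⁅x⁆; x∈⁅y⁆⇒x≡y; p⊆p∪q; p∩q⊆p; x∈p∩q⁺; p⊂q⇒∣p∣<∣q∣; ∣p∣≤n; x∈p⇒∣p-x∣<∣p∣; x∈p∧x≢y⇒x∈p-y; ∣⊥∣≡0; ∣⁅x⁆∣≡1)
open import Data.List using (List; []; _∷_; map; filter; length; deduplicate; allFin)
open import Data.List.Membership.Propositional using (find; lose) renaming (_∈_ to _∈ₗ_)
open import Data.List.Membership.Propositional.Properties using (∈-map⁺; ∈-filter⁺; ∈-allFin; ∈-deduplicate⁺)
open import Data.List.Relation.Unary.Any using (here; there) renaming (any? to anyₗ?)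
open import Data.Vec using ([]; _∷_)
open import Data.Vec.Properties using (≡-dec; lookup∘tabulate; []=⇒lookup; lookup⇒[]=)
open import Data.Product using (Σ; ∃; _×_; _,_; proj₁; proj₂)
open import Data.Sum using (_⊎_; inj₁; inj₂)
open import Data.Empty using (⊥-elim)
open import Relation.Nullary using (¬_; Dec; yes; no; ¬?; does)
open import Relation.Nullary.Decidable using (dec-true; _×-dec_; _⊎-dec_)
open import Relation.Unary using (Decidable)
open import Relation.Binary.Definitions using (DecidableEquality; tri<; tri≈; tri>)
open import Relation.Binary.PropositionalEquality
open import Relation.Binary.Construct.Closure.ReflexiveTransitive using (Star; ε; _◅_)

next-cases : ∀ {m} (i : Fin (suc m)) →
  (toℕ i < m × toℕ (next i) ≡ suc (toℕ i)) ⊎ (toℕ i ≡ m × next i ≡ zero)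
next-cases {m} i with toℕ i <? m
... | yes i<m = inj₁ (i<m , cong suc (toℕ-fromℕ< i<m))
... | no  i≮m = inj₂ (≤-antisym (≤-pred (toℕ<n i)) (≮⇒≥ i≮m) , refl)

leastWitness : ∀ {P : ℕ → Set} → Decidable P → ∀ N → P N →
  ∃ λ m → P m × m ≤ N × (∀ i → i < m → ¬ P i)
leastWitness {P} P? = <-rec Goal search
  where
  Goal : ℕ → Set
  Goal N = P N → ∃ λ m → P m × m ≤ N × (∀ i → i < m → ¬ P i)
  search : ∀ N → (∀ {i} → i < N → Goal i) → Goal N
  search N smaller pN with anyUpTo? P? N
  ... | no none = N , pN , ≤-refl , λ i i<N pi → none (i , i<N , pi)
  ... | yes (i , i<N , pi) with smaller i<N pi
  ...   | m , pm , m≤i , least = m , pm , ≤-trans m≤i (<⇒≤ i<N) , least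

lastWitness : ∀ {m} {P : Fin m → Set} → Decidable P → ∃ P →
  ∃ λ i → P i × (∀ i′ → P i′ → toℕ i′ ≤ toℕ i)
lastWitness {suc m} P? (w , pw) with any? (λ i → P? (suc i))
... | yes later with lastWitness (λ i → P? (suc i)) later
...   | i , pi , largest = suc i , pi , λ { zero _ → z≤n ; (suc i′) p → s≤s (largest i′ p) }
lastWitness {suc m} P? (zero  , pw) | no none = zero , pw , λ { zero _ → z≤n ; (suc i′) p → ⊥-elim (none (i′ , p)) }
lastWitness {suc m} P? (suc w , pw) | no none = ⊥-elim (none (w , pw))

RepeatsAt : ∀ {A : Set} → (ℕ → A) → ℕ → Set
RepeatsAt f x = ∃ λ y → y < x × f y ≡ f x

repeatsAt? : ∀ {A : Set} → DecidableEquality A → (f : ℕ → A) → Decidable (RepeatsAt f)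
repeatsAt? _≟_ f x = anyUpTo? (λ y → f y ≟ f x) x

noRepeat⇒injective : ∀ {A : Set} (f : ℕ → A) J → (∀ x → x < J → ¬ RepeatsAt f x) →
  ∀ a b → a < J → b < J → f a ≡ f b → a ≡ b
noRepeat⇒injective f J noRep a b a<J b<J eq with <-cmp a b
... | tri< a<b _ _ = ⊥-elim (noRep b b<J (a , a<b , eq))
... | tri≈ _ a≡b _ = a≡b
... | tri> _ _ b<a = ⊥-elim (noRep a a<J (b , b<a , sym eq))

InjectiveOn : ∀ {A : Set} → (ℕ → A) → ℕ → ℕ → Set
InjectiveOn f s K = ∀ a b → a < 2 + K → b < 2 + K → f (s + a) ≡ f (s + b) → a ≡ b

window-injective : ∀ {A : Set} (f : ℕ → A) J → (∀ x → x < J → ¬ RepeatsAt f x) →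
  ∀ s K → s + (2 + K) ≤ J → InjectiveOn f s K
window-injective f J noRep s K end a b a< b< eq =
  +-cancelˡ-≡ s a b (noRepeat⇒injective f J noRep (s + a) (s + b) (inWindow a<) (inWindow b<) eq)
  where
  inWindow : ∀ {a} → a < 2 + K → s + a < J
  inWindow a< = <-≤-trans (+-monoʳ-< s a<) end

distance≥2 : ∀ i j → i < j → j ≢ suc i → ∃ λ K → j ≡ i + (2 + K)
distance≥2 i j i<j j≢1+i with m≤n⇒m<n∨m≡n i<j
... | inj₂ 1+i≡j = ⊥-elim (j≢1+i (sym 1+i≡j))
... | inj₁ 1+i<j with m≤n⇒∃[o]m+o≡n 1+i<j
...   | K , eq = K , sym (trans (+-suc i (suc K)) (trans (cong suc (+-suc i K)) eq))

record NonBacktrackingWalk {n} (H : Hypergraph n) : Set where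
  field
    vertexAt    : ℕ → Fin n
    edgeAt      : ℕ → Subset n
    vertex∈V    : ∀ i → vertexAt i ∈ V H
    edge∈E      : ∀ i → edgeAt i ∈ₗ E H
    vertex∈edge : ∀ i → vertexAt i ∈ edgeAt i
    next∈edge   : ∀ i → vertexAt (suc i) ∈ edgeAt i
    vertex-step : ∀ i → vertexAt i ≢ vertexAt (suc i)
    edge-step   : ∀ i → edgeAt i ≢ edgeAt (suc i)

module _ {n} {H : Hypergraph n} (W : NonBacktrackingWalk H) where
  open NonBacktrackingWalk W

  windowCycle : ∀ s K → InjectiveOn vertexAt s K → InjectiveOn edgeAt s K →
    vertexAt s ∈ edgeAt (s + suc K) → BergeCycle H K
  windowCycle s K vInj eInj closes = record
    { vtx     = λ i → vertexAt (s + toℕ i)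
    ; edg     = λ i → edgeAt (s + toℕ i)
    ; vtx-inj = λ {i} {j} eq → toℕ-injective (vInj _ _ (toℕ<n i) (toℕ<n j) eq)
    ; edg-inj = λ {i} {j} eq → toℕ-injective (eInj _ _ (toℕ<n i) (toℕ<n j) eq)
    ; vtx∈V   = λ i → vertex∈V _
    ; edg∈E   = λ i → edge∈E _
    ; here    = λ i → vertex∈edge _
    ; there   = next∈window
    }
    where
    next∈window : ∀ i → vertexAt (s + toℕ (next i)) ∈ edgeAt (s + toℕ i)
    next∈window i with next-cases i
    ... | inj₁ (_ , eq) = subst (λ x → vertexAt x ∈ edgeAt (s + toℕ i))
            (sym (trans (cong (s +_) eq) (+-suc s (toℕ i)))) (next∈edge (s + toℕ i))
    ... | inj₂ (eq , eq′) = subst₂ (λ x y → vertexAt x ∈ edgeAt y)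
            (sym (trans (cong (λ z → s + toℕ z) eq′) (+-identityʳ s))) (sym (cong (s +_) eq)) closes

  -- If the first repeated vertex is at position jv (an earlier copy at iv)
  -- and no edge repeats before jv, the walk segment iv … jv-1 is a cycle.
  vertexRepeatCycle : ∀ iv jv → iv < jv → vertexAt iv ≡ vertexAt jv →
    (∀ x → x < jv → ¬ RepeatsAt vertexAt x) → (∀ x → x < jv → ¬ RepeatsAt edgeAt x) →
    ∃ λ K → BergeCycle H K
  vertexRepeatCycle iv jv iv<jv same vNoRep eNoRep with distance≥2 iv jv iv<jv adjacent
    where
    adjacent : jv ≢ suc iv
    adjacent jv≡1+iv = vertex-step iv (trans same (cong vertexAt jv≡1+iv))
  ... | K , jv≡ = K , windowCycle iv K
    (window-injective vertexAt jv vNoRep iv K (≤-reflexive (sym jv≡)))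
    (window-injective edgeAt jv eNoRep iv K (≤-reflexive (sym jv≡)))
    (subst (_∈ edgeAt (iv + suc K)) (sym (trans same (cong vertexAt last))) (next∈edge (iv + suc K)))
    where
    last : jv ≡ suc (iv + suc K)
    last = trans jv≡ (+-suc iv (suc K))

  -- If the first repeated edge is at position je (an earlier copy at ie)
  -- and no vertex repeats up to je, the segment ie+1 … je is a cycle: it
  -- closes because vertex ie+1 lies on edge ie = edge je.
  edgeRepeatCycle : ∀ ie je → ie < je → edgeAt ie ≡ edgeAt je →
    (∀ x → x < je → ¬ RepeatsAt edgeAt x) → (∀ x → x ≤ je → ¬ RepeatsAt vertexAt x) →
    ∃ λ K → BergeCycle H K
  edgeRepeatCycle ie je ie<je same eNoRep vNoRep with distance≥2 ie je ie<je adjacent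
    where
    adjacent : je ≢ suc ie
    adjacent je≡1+ie = edge-step ie (trans same (cong edgeAt je≡1+ie))
  ... | K , je≡ = K , windowCycle (suc ie) K
    (window-injective vertexAt (suc je) (λ x x< → vNoRep x (≤-pred x<)) (suc ie) K (s≤s (≤-reflexive (sym je≡))))
    edgeInj
    (subst (vertexAt (suc ie) ∈_) (trans same (cong edgeAt end)) (next∈edge ie))
    where
    end : je ≡ suc ie + suc K
    end = trans je≡ (+-suc ie (suc K))
    -- inside the window only the last edge (a copy of edge ie) could repeat,
    -- and it cannot coincide with an earlier window edge either
    distinct : ∀ x → x < 2 + K → ¬ RepeatsAt (λ a → edgeAt (suc ie + a)) x
    distinct x x< (y , y<x , eq) with m≤n⇒m<n∨m≡n (≤-pred x<)
    ... | inj₁ x<1+K = eNoRep (suc ie + x) (subst (suc ie + x <_) (sym end) (+-monoʳ-< (suc ie) x<1+K))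
                              (suc ie + y , +-monoʳ-< (suc ie) y<x , eq)
    ... | inj₂ refl = eNoRep (suc ie + y) (subst (suc ie + y <_) (sym end) (+-monoʳ-< (suc ie) y<x))
                              (ie , s≤s (m≤m+n ie y) , trans same (sym (trans eq (cong edgeAt (sym end)))))
    edgeInj : InjectiveOn edgeAt (suc ie) K
    edgeInj a b a< b< = noRepeat⇒injective (λ a → edgeAt (suc ie + a)) (2 + K) distinct a b a< b<

  -- The first repetition along the walk (of a vertex, or of an edge before
  -- that) produces a Berge cycle; vertices must repeat by pigeonhole.
  walk⇒cycle : ∃ λ K → BergeCycle H K
  walk⇒cycle with pigeonhole (n<1+n n) (λ i → vertexAt (toℕ i))
  ... | i , j , i<j , eq with leastWitness (repeatsAt? _≟ᶠ_ vertexAt) (toℕ j) (toℕ i , i<j , eq)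
  ... | jv , (iv , iv<jv , same) , _ , vNoRep with anyUpTo? (repeatsAt? (≡-dec _≟ᴮ_) edgeAt) jv
  ...   | no none = vertexRepeatCycle iv jv iv<jv same vNoRep (λ x x<jv rep → none (x , x<jv , rep))
  ...   | yes (j′ , j′<jv , rep) with leastWitness (repeatsAt? (≡-dec _≟ᴮ_) edgeAt) j′ rep
  ...     | je , (ie , ie<je , sameE) , je≤j′ , eNoRep =
    edgeRepeatCycle ie je ie<je sameE eNoRep (λ x x≤je → vNoRep x (≤-<-trans x≤je (≤-<-trans je≤j′ j′<jv)))

acyclic⇒noWalk : ∀ {n} {H : Hypergraph n} → ¬ (∃ λ k → BergeCycle H k) → ¬ NonBacktrackingWalk H
acyclic⇒noWalk acyc W = acyc (walk⇒cycle W)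

-- A walk generator: states indexed by the edge through which they were
-- entered, each exposing a current vertex and an exit edge different from
-- the entry edge, together with a successor state entered through the
-- exit edge at a new vertex of that edge.
record WalkGenerator {n} (H : Hypergraph n) : Set₁ where
  field
    State           : Subset n → Set
    vertex          : ∀ {e} → State e → Fin n
    exit            : ∀ {e} → State e → Subset n
    vertex∈V        : ∀ {e} (s : State e) → vertex s ∈ V H
    exit∈E          : ∀ {e} (s : State e) → exit s ∈ₗ E H
    vertex∈exit     : ∀ {e} (s : State e) → vertex s ∈ exit s
    exit≢entry      : ∀ {e} (s : State e) → exit s ≢ e
    successor       : ∀ {e} (s : State e) → State (exit s)
    successor∈exit  : ∀ {e} (s : State e) → vertex (successor s) ∈ exit s
    successor-moves : ∀ {e} (s : State e) → vertex s ≢ vertex (successor s)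

  walkFrom : ∀ {e} → State e → NonBacktrackingWalk H
  walkFrom {e} s₀ = record
    { vertexAt    = λ i → vertex (proj₂ (iterate i))
    ; edgeAt      = λ i → exit (proj₂ (iterate i))
    ; vertex∈V    = λ i → vertex∈V (proj₂ (iterate i))
    ; edge∈E      = λ i → exit∈E (proj₂ (iterate i))
    ; vertex∈edge = λ i → vertex∈exit (proj₂ (iterate i))
    ; next∈edge   = λ i → successor∈exit (proj₂ (iterate i))
    ; vertex-step = λ i → successor-moves (proj₂ (iterate i))
    ; edge-step   = λ i eq → exit≢entry (successor (proj₂ (iterate i))) (sym eq)
    }
    where
    iterate : ℕ → Σ (Subset n) State
    iterate zero    = e , s₀
    iterate (suc i) = let (_ , s) = iterate i in exit s , successor s

Linear : ∀ {n} → Hypergraph n → Set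
Linear H = ∀ {e f x y} → e ∈ₗ E H → f ∈ₗ E H → x ∈ e → x ∈ f → y ∈ e → y ∈ f → x ≢ y → e ≡ f

-- Hypertrees are linear: two distinct edges through two distinct common
-- vertices x, y form the Berge cycle (x, e, y, f, x).
acyclic⇒linear : ∀ {n} {E : List (Subset n)} → ¬ (∃ λ k → BergeCycle (hg ⊤ E) k) → Linear (hg ⊤ E)
acyclic⇒linear {n} acyc {e} {f} {x} {y} e∈ f∈ x∈e x∈f y∈e y∈f x≢y with ≡-dec _≟ᴮ_ e f
... | yes e≡f = e≡f
... | no  e≢f = ⊥-elim (acyc (0 , record
  { vtx = vertex ; edg = edge ; vtx-inj = vertex-inj ; edg-inj = edge-inj
  ; vtx∈V = λ _ → ∈⊤
  ; edg∈E = λ { zero → e∈ ; (suc zero) → f∈ }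
  ; here  = λ { zero → x∈e ; (suc zero) → y∈f }
  ; there = λ { zero → y∈e ; (suc zero) → x∈f } }))
  where
  vertex : Fin 2 → Fin n
  vertex zero = x
  vertex (suc zero) = y
  edge : Fin 2 → Subset n
  edge zero = e
  edge (suc zero) = f
  vertex-inj : ∀ {i j} → vertex i ≡ vertex j → i ≡ j
  vertex-inj {zero}     {zero}     _ = refl
  vertex-inj {zero}     {suc zero} p = ⊥-elim (x≢y p)
  vertex-inj {suc zero} {zero}     p = ⊥-elim (x≢y (sym p))
  vertex-inj {suc zero} {suc zero} _ = refl
  edge-inj : ∀ {i j} → edge i ≡ edge j → i ≡ j
  edge-inj {zero}     {zero}     _ = refl
  edge-inj {zero}     {suc zero} p = ⊥-elim (e≢f p)
  edge-inj {suc zero} {zero}     p = ⊥-elim (e≢f (sym p))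
  edge-inj {suc zero} {suc zero} _ = refl

singleton⊆ : ∀ {n} {x : Fin n} {p : Subset n} → x ∈ p → ⁅ x ⁆ ⊆ p
singleton⊆ {x = x} x∈p z∈ rewrite x∈⁅y⁆⇒x≡y x z∈ = x∈p

pair⊆ : ∀ {n} {x y : Fin n} {p : Subset n} → x ∈ p → y ∈ p → ⁅ x ⁆ ∪ ⁅ y ⁆ ⊆ p
pair⊆ {x = x} {y} x∈p y∈p z∈ with x∈p∪q⁻ ⁅ x ⁆ ⁅ y ⁆ z∈
... | inj₁ z∈x = singleton⊆ x∈p z∈x
... | inj₂ z∈y = singleton⊆ y∈p z∈y

⊈⇒witness : ∀ {n} {e S : Subset n} → ¬ e ⊆ S → ∃ λ x → x ∈ e × x ∉ S
⊈⇒witness {e = e} {S} e⊈S with any? (λ x → (x ∈? e) ×-dec ¬? (x ∈? S))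
... | yes w = w
... | no none = ⊥-elim (e⊈S e⊆S)
  where
  e⊆S : e ⊆ S
  e⊆S {x} x∈e with x ∈? S
  ... | yes x∈S = x∈S
  ... | no  x∉S = ⊥-elim (none (x , x∈e , x∉S))

∪-grows : ∀ {n} {e S : Subset n} → ¬ e ⊆ S → ∣ S ∣ < ∣ S ∪ e ∣
∪-grows {e = e} e⊈S with ⊈⇒witness e⊈S
... | x , x∈e , x∉S = p⊂q⇒∣p∣<∣q∣ (p⊆p∪q e , x , x∈p∪q⁺ (inj₂ x∈e) , x∉S)

module Infection {n} (H : Hypergraph n) (linear : Linear H) where

  Absorbing : Subset n → Set
  Absorbing S = ∀ {e x y} → e ∈ₗ E H → x ∈ e → y ∈ e → x ∈ S → y ∈ S → x ≢ y → e ⊆ S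

  Escape : Subset n → Fin n → Subset n → Set
  Escape S a e = ∃ λ v → v ∉ S × v ∉ e × ∃ λ f → f ∈ₗ E H × a ∈ f × v ∈ f

  Escaping : Subset n → Set
  Escaping S = ∀ {e a} → e ∈ₗ E H → a ∈ e → a ∈ S → ¬ e ⊆ S → Escape S a e

  -- S is stalled when the infection rule can no longer add a new vertex.
  Stalled : Subset n → Set
  Stalled S = Absorbing S × Escaping S

  -- The two ways the rule can fire on e: from a pair of distinct infected
  -- vertices of e, or from a single infected vertex of e without escape.
  PairTrigger : Subset n → Subset n → Set
  PairTrigger S e = ∃ λ x → ∃ λ y → x ∈ e × y ∈ e × x ∈ S × y ∈ S × x ≢ y

  SingleTrigger : Subset n → Subset n → Set
  SingleTrigger S e = ∃ λ a → a ∈ e × a ∈ S × ¬ Escape S a e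

  Trigger : Subset n → Subset n → Set
  Trigger S e = PairTrigger S e ⊎ SingleTrigger S e

  escape? : ∀ S a e → Dec (Escape S a e)
  escape? S a e = any? λ v → ¬? (v ∈? S) ×-dec (¬? (v ∈? e) ×-dec edgeThrough? v)
    where
    edgeThrough? : ∀ v → Dec (∃ λ f → f ∈ₗ E H × a ∈ f × v ∈ f)
    edgeThrough? v with anyₗ? (λ f → (a ∈? f) ×-dec (v ∈? f)) (E H)
    ... | yes some = yes (find some)
    ... | no  none = no λ (f , f∈ , af , vf) → none (lose f∈ (af , vf))

  trigger? : ∀ S e → Dec (Trigger S e)
  trigger? S e = pair? ⊎-dec single?
    where
    pair? : Dec (PairTrigger S e)
    pair? = any? λ x → any? λ y →
      (x ∈? e) ×-dec ((y ∈? e) ×-dec ((x ∈? S) ×-dec ((y ∈? S) ×-dec ¬? (x ≟ᶠ y))))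
    single? : Dec (SingleTrigger S e)
    single? = any? λ a → (a ∈? e) ×-dec ((a ∈? S) ×-dec ¬? (escape? S a e))

  -- For a pair A = {x, y}
  -- the only edge containing A is e itself by linearity; for a single
  -- vertex A = {a}, a vertex of another edge through a outside e would be
  -- an escape.
  trigger⇒step : ∀ {S e} → e ∈ₗ E H → Trigger S e → Step H S (S ∪ e)
  trigger⇒step {S} {e} e∈ (inj₁ (x , y , x∈e , y∈e , x∈S , y∈S , x≢y)) =
    ⁅ x ⁆ ∪ ⁅ y ⁆ , e , (x , x∈p∪q⁺ (inj₁ (x∈⁅x⁆ x))) , pair⊆ x∈S y∈S , e∈ , pair⊆ x∈e y∈e ,
    onlyEdge , refl
    where
    onlyEdge : ∀ v → v ∉ S → (∃ λ f → f ∈ₗ E H × (⁅ x ⁆ ∪ ⁅ y ⁆) ∪ ⁅ v ⁆ ⊆ f) → v ∈ e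
    onlyEdge v _ (f , f∈ , A⊆f) = subst (v ∈_) (sym e≡f) (A⊆f (x∈p∪q⁺ (inj₂ (x∈⁅x⁆ v))))
      where
      e≡f : e ≡ f
      e≡f = linear e∈ f∈ x∈e (A⊆f (x∈p∪q⁺ (inj₁ (x∈p∪q⁺ (inj₁ (x∈⁅x⁆ x))))))
                         y∈e (A⊆f (x∈p∪q⁺ (inj₁ (x∈p∪q⁺ (inj₂ (x∈⁅x⁆ y)))))) x≢y
  trigger⇒step {S} {e} e∈ (inj₂ (a , a∈e , a∈S , noEscape)) =
    ⁅ a ⁆ , e , (a , x∈⁅x⁆ a) , singleton⊆ a∈S , e∈ , singleton⊆ a∈e , inside , refl
    where
    inside : ∀ v → v ∉ S → (∃ λ f → f ∈ₗ E H × ⁅ a ⁆ ∪ ⁅ v ⁆ ⊆ f) → v ∈ e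
    inside v v∉S (f , f∈ , A⊆f) with v ∈? e
    ... | yes v∈e = v∈e
    ... | no  v∉e = ⊥-elim (noEscape (v , v∉S , v∉e , f , f∈ ,
                      A⊆f (x∈p∪q⁺ (inj₁ (x∈⁅x⁆ a))) , A⊆f (x∈p∪q⁺ (inj₂ (x∈⁅x⁆ v)))))

  stepOrStalled : ∀ S → (∃ λ e → ¬ e ⊆ S × Step H S (S ∪ e)) ⊎ Stalled S
  stepOrStalled S with anyₗ? (λ e → ¬? (e ⊆? S) ×-dec trigger? S e) (E H)
  ... | yes some with find some
  ...   | e , e∈ , e⊈S , trig = inj₁ (e , e⊈S , trigger⇒step e∈ trig)
  stepOrStalled S | no none = inj₂ (absorbing , escaping)
    where
    absorbing : Absorbing S
    absorbing {e} e∈ x∈e y∈e x∈S y∈S x≢y with e ⊆? S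
    ... | yes e⊆S = e⊆S
    ... | no  e⊈S = ⊥-elim (none (lose e∈ (e⊈S , inj₁ (_ , _ , x∈e , y∈e , x∈S , y∈S , x≢y))))
    escaping : Escaping S
    escaping {e} {a} e∈ a∈e a∈S e⊈S with escape? S a e
    ... | yes esc = esc
    ... | no  noEsc = ⊥-elim (none (lose e∈ (e⊈S , inj₂ (a , a∈e , a∈S , noEsc))))

  -- Running the infection from any S reaches a stalled set; every firing
  -- step infects a new vertex, so n steps suffice.
  runToStall : ∀ S → ∃ λ S* → Star (Step H) S S* × Stalled S*
  runToStall S = run n S (m≤m+n n ∣ S ∣)
    where
    run : ∀ fuel S → n ≤ fuel + ∣ S ∣ → ∃ λ S* → Star (Step H) S S* × Stalled S*
    run fuel S bound with stepOrStalled S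
    ... | inj₂ stalled = S , ε , stalled
    run zero S bound | inj₁ (e , e⊈S , _) =
      ⊥-elim (<-irrefl refl (<-≤-trans (∪-grows e⊈S) (≤-trans (∣p∣≤n (S ∪ e)) bound)))
    run (suc fuel) S bound | inj₁ (e , e⊈S , step) with run fuel (S ∪ e) bound′
      where
      bound′ : n ≤ fuel + ∣ S ∪ e ∣
      bound′ = ≤-trans bound (≤-trans (≤-reflexive (sym (+-suc fuel ∣ S ∣))) (+-monoʳ-≤ fuel (∪-grows e⊈S)))
    ... | S* , steps , stalled = S* , step ◅ steps , stalled

  infection-grows : ∀ {S S′} → Star (Step H) S S′ → S ⊆ S′
  infection-grows ε x∈S = x∈S
  infection-grows ((_ , _ , _ , _ , _ , _ , _ , refl) ◅ steps) x∈S = infection-grows steps (x∈p∪q⁺ (inj₁ x∈S))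

∈-block : ∀ {n k} (c : Fin n → Fin k) {x j} → c x ≡ j → x ∈ block c j
∈-block c {x} {j} cx≡j = lookup⇒[]= x _ (trans (lookup∘tabulate _ x) (dec-true (c x ≟ᶠ j) cx≡j))

block-label : ∀ {n k} (c : Fin n → Fin k) {x j} → x ∈ block c j → c x ≡ j
block-label c {x} {j} x∈ with c x ≟ᶠ j | trans (sym (lookup∘tabulate (λ y → does (c y ≟ᶠ j)) x)) ([]=⇒lookup x∈)
... | yes cx≡j | _ = cx≡j
... | no  _    | ()

induced-trace : ∀ {n} {V′ f : Subset n} es → f ∈ₗ inducedEdges V′ es → ∃ λ e → e ∈ₗ es × f ≡ e ∩ V′
induced-trace {V′ = V′} (e ∷ es) f∈ with keep e (e ∩ V′)
induced-trace (e ∷ es) (here refl) | true = e , here refl , refl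
induced-trace (e ∷ es) (there f∈)  | true with induced-trace es f∈
... | e′ , e′∈ , eq = e′ , there e′∈ , eq
induced-trace (e ∷ es) f∈ | false with induced-trace es f∈
... | e′ , e′∈ , eq = e′ , there e′∈ , eq

keep-large : ∀ m b → 2 ≤ m → ((1 ≤ᵇ m) ∧ (b ∨ (2 ≤ᵇ m))) ≡ true
keep-large (suc (suc m)) true  _ = refl
keep-large (suc (suc m)) false _ = refl
keep-large (suc zero)    _     (s≤s ())

large-trace-induced : ∀ {n} {V′ e : Subset n} {es} → e ∈ₗ es → 2 ≤ ∣ e ∩ V′ ∣ →
  e ∩ V′ ∈ₗ inducedEdges V′ es
large-trace-induced {V′ = V′} {es = x ∷ es} (here refl) large
  with keep x (x ∩ V′) | keep-large ∣ x ∩ V′ ∣ (∣ x ∣ ≡ᵇ 1) large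
... | true  | _ = here refl
... | false | ()
large-trace-induced {V′ = V′} {es = x ∷ es} (there e∈) large with keep x (x ∩ V′)
... | true  = there (large-trace-induced e∈ large)
... | false = large-trace-induced e∈ large

two≤∣p∣ : ∀ {n} {x y : Fin n} {p : Subset n} → x ∈ p → y ∈ p → x ≢ y → 2 ≤ ∣ p ∣
two≤∣p∣ x∈p y∈p x≢y =
  ≤-trans (s≤s (<-≤-trans (s≤s z≤n) (x∈p⇒∣p-x∣<∣p∣ (x∈p∧x≢y⇒x∈p-y y∈p (λ y≡x → x≢y (sym y≡x))))))
          (x∈p⇒∣p-x∣<∣p∣ x∈p)

member⇒length≥1 : ∀ {A : Set} {x : A} {xs : List A} → x ∈ₗ xs → 1 ≤ length xs
member⇒length≥1 (here _)  = s≤s z≤n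
member⇒length≥1 (there _) = s≤s z≤n

two-distinct⇒length≥2 : ∀ {A : Set} {x y : A} {xs : List A} → x ∈ₗ xs → y ∈ₗ xs → x ≢ y → 2 ≤ length xs
two-distinct⇒length≥2 (here refl) (here refl) x≢y = ⊥-elim (x≢y refl)
two-distinct⇒length≥2 (here refl) (there y∈)  _   = s≤s (member⇒length≥1 y∈)
two-distinct⇒length≥2 (there x∈) (here refl)  _   = s≤s (member⇒length≥1 x∈)
two-distinct⇒length≥2 (there x∈) (there y∈)  x≢y = m≤n⇒m≤1+n (two-distinct⇒length≥2 x∈ y∈ x≢y)

three-distinct⇒length≥3 : ∀ {A : Set} {x y z : A} {xs : List A} → x ∈ₗ xs → y ∈ₗ xs → z ∈ₗ xs →
  x ≢ y → x ≢ z → y ≢ z → 3 ≤ length xs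
three-distinct⇒length≥3 (here refl) (here refl) _           x≢y _   _   = ⊥-elim (x≢y refl)
three-distinct⇒length≥3 (here refl) (there _)   (here refl) _   x≢z _   = ⊥-elim (x≢z refl)
three-distinct⇒length≥3 (here refl) (there y∈)  (there z∈)  _   _   y≢z = s≤s (two-distinct⇒length≥2 y∈ z∈ y≢z)
three-distinct⇒length≥3 (there _)   (here refl) (here refl) _   _   y≢z = ⊥-elim (y≢z refl)
three-distinct⇒length≥3 (there x∈)  (here refl) (there z∈)  _   x≢z _   = s≤s (two-distinct⇒length≥2 x∈ z∈ x≢z)
three-distinct⇒length≥3 (there x∈)  (there y∈)  (here refl) x≢y _   _   = s≤s (two-distinct⇒length≥2 x∈ y∈ x≢y)
three-distinct⇒length≥3 (there x∈)  (there y∈)  (there z∈)  x≢y x≢z y≢z =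
  m≤n⇒m≤1+n (three-distinct⇒length≥3 x∈ y∈ z∈ x≢y x≢z y≢z)

record Branch {n} (H : Hypergraph n) (B : Subset n) (a : Fin n) : Set where
  constructor branch
  field
    edge       : Subset n
    other      : Fin n
    edge∈E     : edge ∈ₗ E H
    a∈edge     : a ∈ edge
    other∈edge : other ∈ edge
    other∈B    : other ∈ B
    a≢other    : a ≢ other

module _ {n} {H : Hypergraph n} {B : Subset n} {a : Fin n} (a∈B : a ∈ B) where

  open Branch

  branch-trace : (β : Branch H B a) →
    edge β ∩ B ∈ₗ deduplicate (≡-dec _≟ᴮ_) (filter (a ∈?_) (inducedEdges B (E H)))
  branch-trace β = ∈-deduplicate⁺ (≡-dec _≟ᴮ_) (∈-filter⁺ (a ∈?_)
    (large-trace-induced (edge∈E β) (two≤∣p∣ (x∈p∩q⁺ (a∈edge β , a∈B)) (x∈p∩q⁺ (other∈edge β , other∈B β)) (a≢other β)))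
    (x∈p∩q⁺ (a∈edge β , a∈B)))

  -- In a linear hypergraph, distinct branches have distinct traces: both
  -- traces would contain a and the second vertex of the first branch.
  branch-traces-distinct : Linear H → (β γ : Branch H B a) → edge β ≢ edge γ → edge β ∩ B ≢ edge γ ∩ B
  branch-traces-distinct linear β γ β≢γ same = β≢γ (linear (edge∈E β) (edge∈E γ) (a∈edge β) (a∈edge γ)
    (other∈edge β) (p∩q⊆p (edge γ) B (subst (other β ∈_) same (x∈p∩q⁺ (other∈edge β , other∈B β))))
    (a≢other β))

  three-branches⇒major : Linear H → (β₁ β₂ β₃ : Branch H B a) →
    edge β₁ ≢ edge β₂ → edge β₁ ≢ edge β₃ → edge β₂ ≢ edge β₃ → Major (induced H B) a
  three-branches⇒major linear β₁ β₂ β₃ d₁₂ d₁₃ d₂₃ = three-distinct⇒length≥3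
    (branch-trace β₁) (branch-trace β₂) (branch-trace β₃)
    (branch-traces-distinct linear β₁ β₂ d₁₂) (branch-traces-distinct linear β₁ β₃ d₁₃)
    (branch-traces-distinct linear β₂ β₃ d₂₃)

-- In a spider cover every block has a centre: a vertex of the block that
-- is its unique major vertex if it has one, and an arbitrary vertex otherwise.
centreOf : ∀ {n k} {H : Hypergraph n} {c : Fin n → Fin k} → SpiderCover H c → ∀ j →
  Σ (Fin n) λ x → x ∈ block c j × (∀ y → y ∈ block c j → Major (induced H (block c j)) y → y ≡ x)
centreOf {H = H} {c} cover j
  with any? (λ x → (x ∈? block c j) ×-dec (3 ≤? deg (induced H (block c j)) x))
... | yes (x , x∈ , major) = x , x∈ , λ y y∈ majorY → proj₂ (proj₂ (cover j)) y x y∈ x∈ majorY major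
... | no noMajor with proj₁ (cover j)
...   | x , x∈ = x , x∈ , λ y y∈ majorY → ⊥-elim (noMajor (y , y∈ , majorY))

image : ∀ {n k} → (Fin k → Fin n) → Subset n
image {k = zero}  f = ∅
image {k = suc k} f = ⁅ f zero ⁆ ∪ image (λ i → f (suc i))

∈-image : ∀ {n k} (f : Fin k → Fin n) j → f j ∈ image f
∈-image f zero    = x∈p∪q⁺ (inj₁ (x∈⁅x⁆ (f zero)))
∈-image f (suc j) = x∈p∪q⁺ (inj₂ (∈-image (λ i → f (suc i)) j))

∣p∪q∣≤∣p∣+∣q∣ : ∀ {n} (p q : Subset n) → ∣ p ∪ q ∣ ≤ ∣ p ∣ + ∣ q ∣
∣p∪q∣≤∣p∣+∣q∣ []          []          = z≤n
∣p∪q∣≤∣p∣+∣q∣ (true ∷ p)  (true ∷ q)  =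
  s≤s (≤-trans (∣p∪q∣≤∣p∣+∣q∣ p q) (≤-trans (n≤1+n _) (≤-reflexive (sym (+-suc ∣ p ∣ ∣ q ∣)))))
∣p∪q∣≤∣p∣+∣q∣ (true ∷ p)  (false ∷ q) = s≤s (∣p∪q∣≤∣p∣+∣q∣ p q)
∣p∪q∣≤∣p∣+∣q∣ (false ∷ p) (true ∷ q)  = ≤-trans (s≤s (∣p∪q∣≤∣p∣+∣q∣ p q)) (≤-reflexive (sym (+-suc ∣ p ∣ ∣ q ∣)))
∣p∪q∣≤∣p∣+∣q∣ (false ∷ p) (false ∷ q) = ∣p∪q∣≤∣p∣+∣q∣ p q

∣image∣≤k : ∀ {n k} (f : Fin k → Fin n) → ∣ image f ∣ ≤ k
∣image∣≤k {n} {zero}  f = ≤-reflexive (∣⊥∣≡0 n)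
∣image∣≤k {n} {suc k} f = begin
  ∣ ⁅ f zero ⁆ ∪ image (λ i → f (suc i)) ∣        ≤⟨ ∣p∪q∣≤∣p∣+∣q∣ ⁅ f zero ⁆ _ ⟩
  ∣ ⁅ f zero ⁆ ∣ + ∣ image (λ i → f (suc i)) ∣     ≡⟨ cong (_+ ∣ image (λ i → f (suc i)) ∣) (∣⁅x⁆∣≡1 (f zero)) ⟩
  suc ∣ image (λ i → f (suc i)) ∣                  ≤⟨ s≤s (∣image∣≤k (λ i → f (suc i))) ⟩
  suc k                                            ∎
  where open ≤-Reasoning

⋃-member : ∀ {n} {x : Fin n} {p : Subset n} {ps : List (Subset n)} → x ∈ p → p ∈ₗ ps → x ∈ ⋃ ps
⋃-member x∈p (here refl) = x∈p∪q⁺ (inj₁ x∈p)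
⋃-member x∈p (there p∈)  = x∈p∪q⁺ (inj₂ (⋃-member x∈p p∈))

module _ {n} (H : Hypergraph n) {S₀ : Subset n} {v : Fin n} (v∈S₀ : v ∈ S₀) where

  private
    N[v]∈ : N[ v ] H ∈ₗ map (λ w → N[ w ] H) (filter (_∈? S₀) (allFin n))
    N[v]∈ = ∈-map⁺ (λ w → N[ w ] H) (∈-filter⁺ (_∈? S₀) (∈-allFin v) v∈S₀)

  initial-seed : v ∈ initial H S₀
  initial-seed = ⋃-member (x∈p∪q⁺ (inj₁ (x∈⁅x⁆ v))) N[v]∈

  initial-edge : ∀ {f} → f ∈ₗ E H → v ∈ f → f ⊆ initial H S₀
  initial-edge f∈ v∈f x∈f = ⋃-member (x∈p∪q⁺ (inj₂ (⋃-member x∈f (∈-filter⁺ (v ∈?_) f∈ v∈f)))) N[v]∈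

inject₁-fromℕ< : ∀ {ℓ} (i : Fin (suc ℓ)) (i<ℓ : toℕ i < ℓ) → inject₁ (fromℕ< i<ℓ) ≡ i
inject₁-fromℕ< i i<ℓ = toℕ-injective (trans (toℕ-inject₁ (fromℕ< i<ℓ)) (toℕ-fromℕ< i<ℓ))

inject₁≢suc : ∀ {ℓ} (t : Fin ℓ) → inject₁ t ≢ suc t
inject₁≢suc t eq = 1+n≢n (sym (trans (sym (toℕ-inject₁ t)) (cong toℕ eq)))

module SpiderInfection {n} (E : List (Subset n)) (acyc : ¬ (∃ λ k → BergeCycle (hg ⊤ E) k))
                       {k} (c : Fin n → Fin k) (cover : SpiderCover (hg ⊤ E) c) where

  T : Hypergraph n
  T = hg ⊤ E

  linear : Linear T
  linear = acyclic⇒linear acyc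

  open Infection T linear

  B : Fin k → Subset n
  B = block c

  spider : Fin k → Hypergraph n
  spider j = induced T (B j)

  centre : Fin k → Fin n
  centre j = proj₁ (centreOf {H = T} {c} cover j)

  centre∈B : ∀ j → centre j ∈ B j
  centre∈B j = proj₁ (proj₂ (centreOf {H = T} {c} cover j))

  major⇒centre : ∀ j {y} → y ∈ B j → Major (spider j) y → y ≡ centre j
  major⇒centre j y∈ major = proj₂ (proj₂ (centreOf {H = T} {c} cover j)) _ y∈ major

  centres : Subset n
  centres = image centre

  module Exhaustion (S : Subset n) (stalled : Stalled S) (centre∈S : ∀ j → centre j ∈ S)
                    (centre-edge⊆S : ∀ j {f} → f ∈ₗ E → centre j ∈ f → f ⊆ S) where

    absorbing : Absorbing S
    absorbing = proj₁ stalled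

    escaping : Escaping S
    escaping = proj₂ stalled

    record Leg (j : Fin k) : Set where
      constructor leg
      field
        len  : ℕ
        path : Path (spider j) len
        ends : vtx path (fromℕ len) ≡ centre j
    open Leg

    legFrom : ∀ x → Σ (Leg (c x)) λ L → vtx (path L) zero ≡ x
    legFrom x with proj₁ (proj₁ (proj₂ (cover (c x)))) x (centre (c x)) (∈-block c refl) (centre∈B (c x))
    ... | ℓ , P , starts , ends = leg ℓ P ends , starts

    module LegEdges {j} (L : Leg j) where

      point : Fin (suc (len L)) → Fin n
      point = vtx (path L)

      private
        trace : (t : Fin (len L)) → ∃ λ e → e ∈ₗ E × edg (path L) t ≡ e ∩ B j
        trace t = induced-trace E (edg∈E (path L) t)

      lift : Fin (len L) → Subset n
      lift t = proj₁ (trace t)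

      lift∈E : ∀ t → lift t ∈ₗ E
      lift∈E t = proj₁ (proj₂ (trace t))

      ⊆lift : ∀ t {x} → x ∈ edg (path L) t → x ∈ lift t
      ⊆lift t {x} x∈ = p∩q⊆p (lift t) (B j) (subst (x ∈_) (proj₂ (proj₂ (trace t))) x∈)

      left∈lift : ∀ t → point (inject₁ t) ∈ lift t
      left∈lift t = ⊆lift t (left (path L) t)

      right∈lift : ∀ t → point (suc t) ∈ lift t
      right∈lift t = ⊆lift t (right (path L) t)

      lift-injective : ∀ {t t′} → lift t ≡ lift t′ → t ≡ t′
      lift-injective {t} {t′} eq = edg-inj (path L)
        (trans (proj₂ (proj₂ (trace t))) (trans (cong (_∩ B j) eq) (sym (proj₂ (proj₂ (trace t′))))))

      before-centre : ∀ i → point i ≢ centre j → toℕ i < len L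
      before-centre i i≢centre = ≤∧≢⇒< (≤-pred (toℕ<n i)) λ i≡len →
        i≢centre (trans (cong point (toℕ-injective (trans i≡len (sym (toℕ-fromℕ (len L)))))) (ends L))

      uninfected-before-centre : ∀ i → point i ∉ S → toℕ i < len L
      uninfected-before-centre i i∉S = before-centre i λ i≡centre → i∉S (subst (_∈ S) (sym i≡centre) (centre∈S j))

      Ahead : Fin (len L) → Set
      Ahead t = ∃ λ i → toℕ t ≤ toℕ i × point i ∉ S

    open LegEdges

    record OnLeg (entry : Subset n) : Set where
      constructor onLeg
      field
        {j}      : Fin k
        L        : Leg j
        pos      : Fin (len L)
        ahead    : Ahead L pos
        fresh    : lift L pos ≢ entry

    record Jump (entry : Subset n) : Set where
      constructor jump
      field
        from to     : Fin n
        by          : Subset n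
        by∈E        : by ∈ₗ E
        from∈by     : from ∈ by
        to∈by       : to ∈ by
        from∈S      : from ∈ S
        to∉S        : to ∉ S
        other-block : c from ≢ c to
        fresh       : by ≢ entry

    State : Subset n → Set
    State entry = OnLeg entry ⊎ Jump entry

    vertexOf : ∀ {e} → State e → Fin n
    vertexOf (inj₁ s) = point (OnLeg.L s) (inject₁ (OnLeg.pos s))
    vertexOf (inj₂ s) = Jump.from s

    exitOf : ∀ {e} → State e → Subset n
    exitOf (inj₁ s) = lift (OnLeg.L s) (OnLeg.pos s)
    exitOf (inj₂ s) = Jump.by s

    Move : Fin n → Subset n → Set
    Move x e = Σ (State e) λ s′ → vertexOf s′ ∈ e × x ≢ vertexOf s′

    -- An
    -- escape from β's edge is a jump out of the block: inside the block it
    -- would be a third branch at a, making a major, i.e. the centre.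
    escape⇒jump : ∀ {j a} → a ∈ B j → a ∈ S → a ≢ centre j →
      (β : Branch T (B j) a) → Branch.other β ∉ S → (γ : Branch T (B j) a) → Branch.edge γ ⊆ S →
      Escape S a (Branch.edge β) → Jump (Branch.edge β)
    escape⇒jump {j} {a} a∈B a∈S a≢centre β x∉S γ γ⊆S (v , v∉S , v∉β , f , f∈ , a∈f , v∈f) =
      jump a v f f∈ a∈f v∈f a∈S v∉S crosses (λ f≡β → v∉β (subst (v ∈_) f≡β v∈f))
      where
      open Branch
      a≢v : a ≢ v
      a≢v a≡v = v∉S (subst (_∈ S) a≡v a∈S)
      crosses : c a ≢ c v
      crosses ca≡cv = a≢centre (major⇒centre j a∈B (three-branches⇒major a∈B linear β γ δ β≢γ β≢δ γ≢δ))
        where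
        δ : Branch T (B j) a
        δ = branch f v f∈ a∈f v∈f (∈-block c (trans (sym ca≡cv) (block-label c a∈B))) a≢v
        β≢γ : edge β ≢ edge γ
        β≢γ eq = x∉S (γ⊆S (subst (other β ∈_) eq (other∈edge β)))
        β≢δ : edge β ≢ f
        β≢δ eq = v∉β (subst (v ∈_) (sym eq) v∈f)
        γ≢δ : edge γ ≢ f
        γ≢δ eq = v∉S (γ⊆S (subst (v ∈_) (sym eq) v∈f))

    advance : ∀ {j} (L : Leg j) t → (∃ λ i → toℕ t < toℕ i × point L i ∉ S) →
      Move (point L (inject₁ t)) (lift L t)
    advance L t (i , t<i , i∉S) =
      inj₁ (onLeg L t⁺ (i , ≤-trans (≤-reflexive (toℕ-fromℕ< t⁺<len)) t<i , i∉S) fresh) ,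
      subst (λ p → point L p ∈ lift L t) (sym t⁺≡suc) (right∈lift L t) ,
      λ eq → inject₁≢suc t (vtx-inj (path L) (trans eq (cong (point L) t⁺≡suc)))
      where
      t⁺<len : toℕ (suc t) < len L
      t⁺<len = ≤-<-trans t<i (uninfected-before-centre L i i∉S)
      t⁺ : Fin (len L)
      t⁺ = fromℕ< t⁺<len
      t⁺≡suc : inject₁ t⁺ ≡ suc t
      t⁺≡suc = inject₁-fromℕ< (suc t) t⁺<len
      fresh : lift L t⁺ ≢ lift L t
      fresh eq = inject₁≢suc t (trans (cong inject₁ (sym (lift-injective L eq))) t⁺≡suc)

    -- If point t is the last uninfected point of the leg, the infected
    -- point a after it is not the centre, the following edge is infected,
    -- and an escape from the current edge at a jumps to another block.
    leave : ∀ {j} (L : Leg j) t → point L (inject₁ t) ∉ S → (∀ i → toℕ t < toℕ i → point L i ∈ S) →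
      Move (point L (inject₁ t)) (lift L t)
    leave {j} L t x∉S beyond =
      inj₂ (escape⇒jump a∈B a∈S a≢centre current x∉S following following⊆S
             (escaping (lift∈E L t) (right∈lift L t) a∈S (λ t⊆S → x∉S (t⊆S (left∈lift L t))))) ,
      right∈lift L t , λ x≡a → inject₁≢suc t (vtx-inj (path L) x≡a)
      where
      a : Fin n
      a = point L (suc t)
      a∈S : a ∈ S
      a∈S = beyond (suc t) ≤-refl
      a∈B : a ∈ B j
      a∈B = vtx∈V (path L) (suc t)
      a≢centre : a ≢ centre j
      a≢centre a≡centre = x∉S (centre-edge⊆S j (lift∈E L t) (subst (_∈ lift L t) a≡centre (right∈lift L t)) (left∈lift L t))
      t⁺<len : toℕ (suc t) < len L
      t⁺<len = before-centre L (suc t) a≢centre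
      t⁺ : Fin (len L)
      t⁺ = fromℕ< t⁺<len
      a∈following : a ∈ lift L t⁺
      a∈following = subst (λ p → point L p ∈ lift L t⁺) (inject₁-fromℕ< (suc t) t⁺<len) (left∈lift L t⁺)
      a≢b : a ≢ point L (suc t⁺)
      a≢b a≡b = inject₁≢suc t⁺ (trans (inject₁-fromℕ< (suc t) t⁺<len) (vtx-inj (path L) a≡b))
      following⊆S : lift L t⁺ ⊆ S
      following⊆S = absorbing (lift∈E L t⁺) a∈following (right∈lift L t⁺) a∈S
        (beyond (suc t⁺) (s≤s (≤-trans (n≤1+n _) (≤-reflexive (sym (toℕ-fromℕ< t⁺<len)))))) a≢b
      current : Branch T (B j) a
      current = branch (lift L t) (point L (inject₁ t)) (lift∈E L t) (right∈lift L t) (left∈lift L t)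
                  (vtx∈V (path L) (inject₁ t)) (λ a≡x → x∉S (subst (_∈ S) a≡x a∈S))
      following : Branch T (B j) a
      following = branch (lift L t⁺) (point L (suc t⁺)) (lift∈E L t⁺) a∈following (right∈lift L t⁺)
                    (vtx∈V (path L) (suc t⁺)) a≢b

    stepOnLeg : ∀ {e} (s : OnLeg e) → Move (vertexOf (inj₁ s)) (exitOf (inj₁ s))
    stepOnLeg (onLeg L t (i , t≤i , i∉S) _) with any? (λ i′ → (toℕ t <? toℕ i′) ×-dec ¬? (point L i′ ∈? S))
    ... | yes further = advance L t further
    ... | no none = leave L t x∉S beyond
      where
      beyond : ∀ i → toℕ t < toℕ i → point L i ∈ S
      beyond i t<i with point L i ∈? S
      ... | yes i∈S = i∈S
      ... | no  i∉S = ⊥-elim (none (i , t<i , i∉S))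
      x∉S : point L (inject₁ t) ∉ S
      x∉S with m≤n⇒m<n∨m≡n t≤i
      ... | inj₁ t<i = ⊥-elim (none (i , t<i , i∉S))
      ... | inj₂ t≡i = subst (λ p → point L p ∉ S) (toℕ-injective (trans (sym t≡i) (sym (toℕ-inject₁ t)))) i∉S

    -- After a jump, follow the leg from `to` and enter it at the last point
    -- m lying on the jump edge; m is uninfected, as otherwise the jump edge
    -- would have been absorbed, and the leg edge at m is not the jump edge.
    stepJump : ∀ {e} (s : Jump e) → Move (Jump.from s) (Jump.by s)
    stepJump (jump a v f f∈ a∈f v∈f a∈S v∉S crosses _) with legFrom v
    ... | L , starts with lastWitness (λ i → point L i ∈? f) (zero , subst (_∈ f) (sym starts) v∈f)
    ... | m , m∈f , largest =
      inj₁ (onLeg L m′ (m , ≤-reflexive (toℕ-fromℕ< m<len) , m∉S) fresh) ,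
      subst (λ p → point L p ∈ f) (sym m′≡m) m∈f ,
      λ a≡m → a≢m (trans a≡m (cong (point L) m′≡m))
      where
      a≢m : a ≢ point L m
      a≢m a≡m = crosses (trans (cong c a≡m) (block-label c (vtx∈V (path L) m)))
      m∉S : point L m ∉ S
      m∉S m∈S = v∉S (absorbing f∈ a∈f m∈f a∈S m∈S a≢m v∈f)
      m<len : toℕ m < len L
      m<len = uninfected-before-centre L m m∉S
      m′ : Fin (len L)
      m′ = fromℕ< m<len
      m′≡m : inject₁ m′ ≡ m
      m′≡m = inject₁-fromℕ< m m<len
      fresh : lift L m′ ≢ f
      fresh eq = 1+n≰n (subst (_≤ toℕ m) (cong suc (toℕ-fromℕ< m<len))
                   (largest (suc m′) (subst (point L (suc m′) ∈_) eq (right∈lift L m′))))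

    step : ∀ {e} (s : State e) → Move (vertexOf s) (exitOf s)
    step (inj₁ s) = stepOnLeg s
    step (inj₂ s) = stepJump s

    walks : WalkGenerator T
    walks = record
      { State = State ; vertex = vertexOf ; exit = exitOf
      ; vertex∈V = λ _ → ∈⊤
      ; exit∈E = λ { (inj₁ s) → lift∈E (OnLeg.L s) (OnLeg.pos s) ; (inj₂ s) → Jump.by∈E s }
      ; vertex∈exit = λ { (inj₁ s) → left∈lift (OnLeg.L s) (OnLeg.pos s) ; (inj₂ s) → Jump.from∈by s }
      ; exit≢entry = λ { (inj₁ s) → OnLeg.fresh s ; (inj₂ s) → Jump.fresh s }
      ; successor = λ s → proj₁ (step s)
      ; successor∈exit = λ s → proj₁ (proj₂ (step s))
      ; successor-moves = λ s → proj₂ (proj₂ (step s))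
      }

    -- An uninfected vertex u is not a centre, so its leg has a first edge,
    -- at which a walk starts.
    start : ∀ u → u ∉ S → State ∅
    start u u∉S with legFrom u
    ... | L , starts = inj₁ (onLeg L first (zero , ≤-reflexive (toℕ-fromℕ< 0<len) , first∉S) fresh)
      where
      first∉S : point L zero ∉ S
      first∉S = subst (_∉ S) (sym starts) u∉S
      0<len : 0 < len L
      0<len = uninfected-before-centre L zero first∉S
      first : Fin (len L)
      first = fromℕ< 0<len
      fresh : lift L first ≢ ∅
      fresh eq = ∉⊥ (subst (point L (inject₁ first) ∈_) eq (left∈lift L first))

    all-infected : ∀ u → u ∈ S
    all-infected u with u ∈? S
    ... | yes u∈S = u∈S
    ... | no  u∉S = ⊥-elim (acyclic⇒noWalk acyc (WalkGenerator.walkFrom walks (start u u∉S)))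

  centres-dominate : IPDSet T centres
  centres-dominate with runToStall (initial T centres)
  ... | S* , steps , stalled = subst (Star (Step T) (initial T centres)) everything steps
    where
    everything : S* ≡ ⊤
    everything = ⊆-antisym ⊆⊤ λ {x} _ → Exhaustion.all-infected S* stalled
      (λ j → infection-grows steps (initial-seed T (∈-image centre j)))
      (λ j f∈ centre∈f x∈f → infection-grows steps (initial-edge T (∈-image centre j) f∈ centre∈f x∈f)) x

corollary5p5 : ∀ {n} (E : List (Subset n)) →
    (∀ e → e ∈ₗ E → Nonempty e) → Reduced E →
    Hypertree (hg ⊤ E) →
    ∀ k (c : Fin n → Fin k) → SpiderCover (hg ⊤ E) c →
    γPI≤ (hg ⊤ E) k
corollary5p5 E _ _ (_ , acyclic) k c cover = centres , ∣image∣≤k centre , centres-dominate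
  where open SpiderInfection E acyclic c cover
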